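{- Let $M$ be a transversal matroid of rank $r$ on $E$ and $\mathcal{A}$ a presentation of $M$. The sets in $L_\mathcal{A}$ are exactly: (1) the sets $s_\mathcal{A}(X)$ where $X$ is an independent set of $M$ with $|X|=|s_\mathcal{A}(X)|$, and (2) all intersections of such sets. In particular, for $I\in L_\mathcal{A}$, if $\mathcal{C}_x$ is the set of all circuits of $M[\mathcal{A}^I]$ that contain $x$, then $$I=\bigcap_{C\in\mathcal{C}_x}s_\mathcal{A}(C-\{x\}).$$ Moreover, item (1) may be replaced by: (1$'$) the sets $s_\mathcal{A}(Y)$ with $Y\subseteq E$ and $r(Y)=|s_\mathcal{A}(Y)|$.
   Context: $[r]=\{1,\dots,r\}$. For a set system $\mathcal{A}=(A_i:i\in[r])$ on a finite set $E$, $M[\mathcal{A}]$ is the transversal matroid on $E$ whose independent sets are the partial transversals of $\mathcal{A}$ (sets $X\subseteq E$ admitting an injection $\phi:X\to[r]$ with $e\in A_{\phi(e)}$); $\mathcal{A}$ is a presentation of $M[\mathcal{A}]$, and presentations of a rank-$r$ matroid are taken to have exactly $r$ sets. For $X\subseteq E$, the support is $s_\mathcal{A}(X)=\{i\in[r]: X\cap A_i\neq\emptyset\}$. Fix $x\notin E$; for $I\subseteq[r]$, $\mathcal{A}^I$ is obtained from $\mathcal{A}$ by replacing $A_i$ by $A_i\cup\{x\}$ for each $i\in I$. Let $\sigma_\mathcal{A}(I)=I\cup\{k\in[r]-I: x\text{ is a coloop of } M[\mathcal{A}^I]\backslash A_k\}$; $L_\mathcal{A}$ is the set of $I\subseteq[r]$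 with $\sigma_\mathcal{A}(I)=I$. $r(\cdot)$ is the rank function of $M$. An empty intersection is interpreted as $[r]$. -}

module Defs where

open import Data.Nat using (ℕ; suc; _≤_)
open import Data.Bool using (Bool; true; false; _∨_)
open import Data.Fin using (Fin; zero; suc)
open import Data.Fin.Subset using (Subset; _∈_; _∉_; _⊆_; _∪_; _∩_; ⁅_⁆; _-_; ∁; ∣_∣; ⊤)
open import Data.Vec using (Vec; []; _∷_; lookup; tabulate; tail)
open import Data.Product using (Σ; _×_; ∃)
open import Data.Sum using (_⊎_)
open import Relation.Nullary using (¬_)
open import Relation.Binary.PropositionalEquality using (_≡_)

SetSystem : ℕ → ℕ → Set
SetSystem r n = Fin r → Subset n

PartialTransversal : ∀ {r m} → SetSystem r m → Subset m → Set
PartialTransversal {r} {m} 𝒜 X =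
  Σ ((e : Fin m) → e ∈ X → Fin r) λ φ →
    ((e : Fin m) (p : e ∈ X) → e ∈ 𝒜 (φ e p)) ×
    ((e f : Fin m) (p : e ∈ X) (q : f ∈ X) → φ e p ≡ φ f q → e ≡ f)

Indep : ∀ {r m} → SetSystem r m → Subset m → Set
Indep = PartialTransversal

HasRank : ∀ {r m} → SetSystem r m → Subset m → ℕ → Set
HasRank 𝒜 Y k =
  (∃ λ X → X ⊆ Y × Indep 𝒜 X × ∣ X ∣ ≡ k) ×
  (∀ X → X ⊆ Y → Indep 𝒜 X → ∣ X ∣ ≤ k)

Circuit : ∀ {r m} → SetSystem r m → Subset m → Set
Circuit 𝒜 C = ¬ Indep 𝒜 C × (∀ e → e ∈ C → Indep 𝒜 (C - e))

-- Bases of the restriction M|G (= deletion of the complement of G).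
BasisOf : ∀ {r m} → SetSystem r m → Subset m → Subset m → Set
BasisOf 𝒜 G B =
  B ⊆ G × Indep 𝒜 B × (∀ e → e ∈ G → e ∉ B → ¬ Indep 𝒜 (B ∪ ⁅ e ⁆))

IsColoop : ∀ {r m} → SetSystem r m → Subset m → Fin m → Set
IsColoop 𝒜 G y = y ∈ G × (∀ B → BasisOf 𝒜 G B → y ∈ B)

anyB : ∀ {n} → Subset n → Bool
anyB []       = false
anyB (b ∷ bs) = b ∨ anyB bs

supp : ∀ {r n} → SetSystem r n → Subset n → Subset r
supp 𝒜 X = tabulate λ i → anyB (X ∩ 𝒜 i)

-- Ground set E ∪ {x} is Fin (suc n), with x = zero and e ∈ E as suc e.
x₀ : ∀ {n} → Fin (suc n)
x₀ = zero

-- 𝒜^I: add x to A_i for each i ∈ I.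
ext : ∀ {r n} → SetSystem r n → Subset r → SetSystem r (suc n)
ext 𝒜 I i = lookup I i ∷ 𝒜 i

-- Membership in σ_𝒜(I): k ∈ I, or k ∉ I and x is a coloop of M[𝒜^I] \ A_k.
_∈σ[_]_ : ∀ {r n} → Fin r → SetSystem r n → Subset r → Set
k ∈σ[ 𝒜 ] I = k ∈ I ⊎ (k ∉ I × IsColoop (ext 𝒜 I) (true ∷ ∁ (𝒜 k)) x₀)

InL : ∀ {r n} → SetSystem r n → Subset r → Set
InL 𝒜 I = ∀ k → (k ∈σ[ 𝒜 ] I → k ∈ I) × (k ∈ I → k ∈σ[ 𝒜 ] I)

Good1 : ∀ {r n} → SetSystem r n → Subset n → Set
Good1 𝒜 X = Indep 𝒜 X × ∣ X ∣ ≡ ∣ supp 𝒜 X ∣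

Good1' : ∀ {r n} → SetSystem r n → Subset n → Set
Good1' 𝒜 Y = HasRank 𝒜 Y ∣ supp 𝒜 Y ∣

module Submission where

-- Write M_I = M[𝒜^I] for the matroid on E + x in which x joins the sets A_i, i ∈ I,
-- and call X ⊆ E tight if X is independent in M and |X| = |s(X)|.
--
--   * Hall's theorem: X is independent in M[𝒜] iff |T| ≤ |s(T)| for every T ⊆ X.
--     It makes independence decidable and yields a deficient subset of a dependent set.
--   * The tightness lemma: for X independent in M, X + x is dependent in M_I iff some
--     tight T ⊆ X has I ⊆ s(T).
--   * Consequently, for k ∉ I, x is a coloop of M_I \ A_k iff no tight X separates k
--     from I (I ⊆ s(X), k ∉ s(X)); so I ∈ L_𝒜 iff every k ∉ I is separated from I.
--
-- A purely set-theoretic lemma turns "every k ∉ I is separated from I by a support" into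
-- "I is an intersection of supports", which gives (1) and (2).  The circuit formula
-- follows from the tightness lemma applied to C - x, and (1') from the observation that
-- r(Y) = |s(Y)| exactly when s(Y) = s(X) for a tight X ⊆ Y.

open import Defs
open import Data.Nat using (ℕ; zero; suc; _+_; _≤_; _<_; z≤n; s≤s; _≟_; _<?_)
open import Data.Nat.Properties
  using (≤-refl; ≤-trans; ≤-antisym; ≤-reflexive; ≤-pred; +-suc; +-comm; +-identityʳ; +-monoʳ-≤;
         +-cancelʳ-≤; <⇒≱; ≮⇒≥; m≤m+n; module ≤-Reasoning)
open import Data.Bool using (true; false; if_then_else_)
open import Data.Bool.Properties using (∨-zeroʳ)
open import Data.Fin using (Fin; zero; suc)
open import Data.Fin.Properties using (any?; all?; ¬∀⟶∃¬; suc-injective; 0≢1+n)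
open import Data.Fin.Subset using (Subset; _∈_; _∉_; _⊆_; _⊂_; _∪_; _∩_; ⁅_⁆; _-_; _─_; ∁; ∣_∣; ⋂; ⊤; ⊥; Nonempty; Empty)
open import Data.Fin.Subset.Properties
  using (_∈?_; _⊆?_; _⊂?_; anySubset?; nonempty?; drop-there; x∈p∩q⁺; x∈p∩q⁻; x∈p∪q⁺; x∈p∪q⁻;
         ⊆-antisym; ⊆-trans; p⊆q⇒∣p∣≤∣q∣; p⊂q⇒∣p∣<∣q∣; ∣p∣≤n; ∣⊥∣≡0; ∉⊥; x∈⁅x⁆; x∈⁅y⁆⇒x≡y;
         ∣⁅x⁆∣≡1; x∈p∧x≢y⇒x∈p-y; x∈p∧x∉q⇒x∈p─q; p─q⊆p; p─⊥≡p; x∈p⇒∣p-x∣<∣p∣; p∩q≢∅⇒∣p─q∣<∣p∣;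
         ∪-identityʳ; q⊆p∪q; x∈∁p⇒x∉p; x∉p⇒x∈∁p; ∈⊤; Empty-unique)
open import Data.Vec using ([]; _∷_; lookup; tail; here; there)
open import Data.Vec.Properties using ([]=⇒lookup; lookup⇒[]=; lookup∘tabulate)
open import Data.List using (List; map; []; _∷_; allFin)
open import Data.List.Relation.Unary.All using (All; []; _∷_)
open import Data.List.Relation.Unary.Any using (here; there)
open import Data.List.Membership.Propositional using () renaming (_∈_ to _∈ₗ_)
open import Data.List.Membership.Propositional.Properties using (∈-allFin)
open import Data.Product using (Σ; _×_; ∃; _,_; proj₁; proj₂)
open import Data.Sum using (_⊎_; inj₁; inj₂)
open import Data.Empty using (⊥-elim)
open import Relation.Nullary using (¬_; Dec; yes; no; contradiction)
open import Relation.Nullary.Decidable using (_×-dec_; _→-dec_; ¬?)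
open import Relation.Binary.PropositionalEquality using (_≡_; refl; sym; trans; cong; subst)

variable
  r m : ℕ

x∈p─q⁻ : ∀ {k} (p q : Subset k) {x : Fin k} → x ∈ p ─ q → x ∈ p × x ∉ q
x∈p─q⁻ (b ∷ p) (true ∷ q) {zero} ()
x∈p─q⁻ (true ∷ p) (false ∷ q) {zero} here = here , λ ()
x∈p─q⁻ (b ∷ p) (c ∷ q) {suc x} (there x∈) with x∈p─q⁻ p q x∈
... | x∈p , x∉q = there x∈p , λ x∈q → x∉q (drop-there x∈q)

∪-⊆ : ∀ {k} {p q s : Subset k} → p ⊆ s → q ⊆ s → p ∪ q ⊆ s
∪-⊆ {p = p} {q} p⊆s q⊆s x∈ with x∈p∪q⁻ p q x∈
... | inj₁ x∈p = p⊆s x∈p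
... | inj₂ x∈q = q⊆s x∈q

∣p∪q∣+∣p∩q∣≡∣p∣+∣q∣ : ∀ {k} (p q : Subset k) → ∣ p ∪ q ∣ + ∣ p ∩ q ∣ ≡ ∣ p ∣ + ∣ q ∣
∣p∪q∣+∣p∩q∣≡∣p∣+∣q∣ [] [] = refl
∣p∪q∣+∣p∩q∣≡∣p∣+∣q∣ (true ∷ p) (true ∷ q) =
  cong suc (trans (+-suc _ _) (trans (cong suc (∣p∪q∣+∣p∩q∣≡∣p∣+∣q∣ p q)) (sym (+-suc _ _))))
∣p∪q∣+∣p∩q∣≡∣p∣+∣q∣ (true ∷ p) (false ∷ q) = cong suc (∣p∪q∣+∣p∩q∣≡∣p∣+∣q∣ p q)
∣p∪q∣+∣p∩q∣≡∣p∣+∣q∣ (false ∷ p) (true ∷ q) = trans (cong suc (∣p∪q∣+∣p∩q∣≡∣p∣+∣q∣ p q)) (sym (+-suc _ _))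
∣p∪q∣+∣p∩q∣≡∣p∣+∣q∣ (false ∷ p) (false ∷ q) = ∣p∪q∣+∣p∩q∣≡∣p∣+∣q∣ p q

∣p∪q∣≤∣p∣+∣q∣ : ∀ {k} (p q : Subset k) → ∣ p ∪ q ∣ ≤ ∣ p ∣ + ∣ q ∣
∣p∪q∣≤∣p∣+∣q∣ p q = ≤-trans (m≤m+n _ _) (≤-reflexive (∣p∪q∣+∣p∩q∣≡∣p∣+∣q∣ p q))

∣Empty∣≡0 : ∀ {k} {p : Subset k} → Empty p → ∣ p ∣ ≡ 0
∣Empty∣≡0 {k} empty = trans (cong ∣_∣ (Empty-unique empty)) (∣⊥∣≡0 k)

∣p∪q∣≡∣p∣+∣q∣ : ∀ {k} (p q : Subset k) → (∀ {x} → x ∈ p → x ∉ q) → ∣ p ∪ q ∣ ≡ ∣ p ∣ + ∣ q ∣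
∣p∪q∣≡∣p∣+∣q∣ p q disjoint = begin
  ∣ p ∪ q ∣               ≡⟨ sym (+-identityʳ _) ⟩
  ∣ p ∪ q ∣ + 0           ≡⟨ cong (∣ p ∪ q ∣ +_) (sym (∣Empty∣≡0 p∩q-empty)) ⟩
  ∣ p ∪ q ∣ + ∣ p ∩ q ∣   ≡⟨ ∣p∪q∣+∣p∩q∣≡∣p∣+∣q∣ p q ⟩
  ∣ p ∣ + ∣ q ∣           ∎
  where
  open Relation.Binary.PropositionalEquality.≡-Reasoning
  p∩q-empty : Empty (p ∩ q)
  p∩q-empty (x , x∈) = let (x∈p , x∈q) = x∈p∩q⁻ p q x∈ in disjoint x∈p x∈q

∣p∪⁅x⁆∣≡1+∣p∣ : ∀ {k} (p : Subset k) (x : Fin k) → x ∉ p → ∣ p ∪ ⁅ x ⁆ ∣ ≡ suc ∣ p ∣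
∣p∪⁅x⁆∣≡1+∣p∣ p x x∉p =
  trans (∣p∪q∣≡∣p∣+∣q∣ p ⁅ x ⁆ (λ y∈p y∈⁅x⁆ → x∉p (subst (_∈ p) (x∈⁅y⁆⇒x≡y x y∈⁅x⁆) y∈p)))
        (trans (cong (∣ p ∣ +_) (∣⁅x⁆∣≡1 x)) (+-comm ∣ p ∣ 1))

∣p∣≡1+∣p-x∣ : ∀ {k} (p : Subset k) (x : Fin k) → x ∈ p → ∣ p ∣ ≡ suc ∣ p - x ∣
∣p∣≡1+∣p-x∣ (true ∷ p) zero here = cong suc (cong ∣_∣ (sym (p─⊥≡p p)))
∣p∣≡1+∣p-x∣ (true ∷ p) (suc x) (there x∈p) = cong suc (∣p∣≡1+∣p-x∣ p x x∈p)
∣p∣≡1+∣p-x∣ (false ∷ p) (suc x) (there x∈p) = ∣p∣≡1+∣p-x∣ p x x∈p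

⊆∧∣q∣≤∣p∣⇒q⊆p : ∀ {k} {p q : Subset k} → p ⊆ q → ∣ q ∣ ≤ ∣ p ∣ → q ⊆ p
⊆∧∣q∣≤∣p∣⇒q⊆p {p = p} p⊆q ∣q∣≤∣p∣ {x} x∈q with x ∈? p
... | yes x∈p = x∈p
... | no x∉p = contradiction ∣q∣≤∣p∣ (<⇒≱ (p⊂q⇒∣p∣<∣q∣ (p⊆q , x , x∈q , x∉p)))

injection⇒∣p∣≤∣q∣ : ∀ {k} (p : Subset m) (q : Subset k) (φ : (e : Fin m) → e ∈ p → Fin k) →
  (∀ e e∈p → φ e e∈p ∈ q) → (∀ e f e∈p f∈p → φ e e∈p ≡ φ f f∈p → e ≡ f) → ∣ p ∣ ≤ ∣ q ∣
injection⇒∣p∣≤∣q∣ [] q φ into inj = z≤n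
injection⇒∣p∣≤∣q∣ (false ∷ p) q φ into inj =
  injection⇒∣p∣≤∣q∣ p q (λ e e∈p → φ (suc e) (there e∈p)) (λ e e∈p → into (suc e) (there e∈p))
    (λ e f e∈p f∈p eq → suc-injective (inj (suc e) (suc f) (there e∈p) (there f∈p) eq))
injection⇒∣p∣≤∣q∣ {k = k} (true ∷ p) q φ into inj =
  ≤-trans (s≤s (injection⇒∣p∣≤∣q∣ p (q - j) (λ e e∈p → φ (suc e) (there e∈p)) into-q-j
    (λ e f e∈p f∈p eq → suc-injective (inj (suc e) (suc f) (there e∈p) (there f∈p) eq))))
    (≤-reflexive (sym (∣p∣≡1+∣p-x∣ q j (into zero here))))
  where
  j : Fin k
  j = φ zero here
  into-q-j : ∀ e e∈p → φ (suc e) (there e∈p) ∈ q - j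
  into-q-j e e∈p = x∈p∧x≢y⇒x∈p-y (into (suc e) (there e∈p)) λ eq → 0≢1+n (sym (inj (suc e) zero (there e∈p) here eq))

anyB⁺ : ∀ {k} (p : Subset k) {e : Fin k} → e ∈ p → anyB p ≡ true
anyB⁺ (true ∷ p) {zero} here = refl
anyB⁺ (b ∷ p) {suc e} (there e∈p) rewrite anyB⁺ p e∈p = ∨-zeroʳ b

anyB⁻ : ∀ {k} (p : Subset k) → anyB p ≡ true → Nonempty p
anyB⁻ (true ∷ p) _ = zero , here
anyB⁻ (false ∷ p) any with anyB⁻ p any
... | e , e∈p = suc e , there e∈p

supp⁺ : (𝒜 : SetSystem r m) {X : Subset m} {e : Fin m} {i : Fin r} → e ∈ X → e ∈ 𝒜 i → i ∈ supp 𝒜 X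
supp⁺ 𝒜 {X} {e} {i} e∈X e∈Aᵢ =
  lookup⇒[]= i _ (trans (lookup∘tabulate _ i) (anyB⁺ (X ∩ 𝒜 i) (x∈p∩q⁺ (e∈X , e∈Aᵢ))))

supp⁻ : (𝒜 : SetSystem r m) {X : Subset m} {i : Fin r} → i ∈ supp 𝒜 X → ∃ λ e → e ∈ X × e ∈ 𝒜 i
supp⁻ 𝒜 {X} {i} i∈s with anyB⁻ (X ∩ 𝒜 i) (trans (sym (lookup∘tabulate _ i)) ([]=⇒lookup i∈s))
... | e , e∈ = e , x∈p∩q⁻ X (𝒜 i) e∈

supp-mono : (𝒜 : SetSystem r m) {X Y : Subset m} → X ⊆ Y → supp 𝒜 X ⊆ supp 𝒜 Y
supp-mono 𝒜 X⊆Y i∈s with supp⁻ 𝒜 i∈s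
... | e , e∈X , e∈Aᵢ = supp⁺ 𝒜 (X⊆Y e∈X) e∈Aᵢ

Indep-⊆ : (𝒜 : SetSystem r m) {W Z : Subset m} → W ⊆ Z → Indep 𝒜 Z → Indep 𝒜 W
Indep-⊆ 𝒜 W⊆Z (φ , adj , inj) =
  (λ e p → φ e (W⊆Z p)) , (λ e p → adj e (W⊆Z p)) , (λ e f p q eq → inj e f (W⊆Z p) (W⊆Z q) eq)

Indep-empty : (𝒜 : SetSystem r m) {Z : Subset m} → Empty Z → Indep 𝒜 Z
Indep-empty 𝒜 empty =
  (λ e p → ⊥-elim (empty (e , p))) , (λ e p → ⊥-elim (empty (e , p))) , (λ e f p q _ → ⊥-elim (empty (e , p)))

HallCondition : SetSystem r m → Subset m → Set
HallCondition 𝒜 Z = ∀ T → T ⊆ Z → ∣ T ∣ ≤ ∣ supp 𝒜 T ∣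

-- Necessity of Hall's condition: a transversal of T injects T into s(T).
Indep⇒Hall : (𝒜 : SetSystem r m) {Z : Subset m} → Indep 𝒜 Z → HallCondition 𝒜 Z
Indep⇒Hall 𝒜 indZ T T⊆Z with Indep-⊆ 𝒜 T⊆Z indZ
... | φ , adj , inj = injection⇒∣p∣≤∣q∣ T (supp 𝒜 T) φ (λ e e∈T → supp⁺ 𝒜 e∈T (adj e e∈T)) inj

-- Both inductive
-- steps match a part T of Z into a set N of indices and the rest Z ─ T into the
-- system with the indices in N removed.

dropIndices : SetSystem r m → Subset r → SetSystem r m
dropIndices 𝒜 N j = if lookup N j then ⊥ else 𝒜 j

dropIndices⁻ : (𝒜 : SetSystem r m) (N : Subset r) {e : Fin m} {j : Fin r} →
  e ∈ dropIndices 𝒜 N j → e ∈ 𝒜 j × j ∉ N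
dropIndices⁻ 𝒜 N {e} {j} e∈ with lookup N j in eq
... | true = ⊥-elim (∉⊥ e∈)
... | false = e∈ , λ j∈N → contradiction (trans (sym ([]=⇒lookup j∈N)) eq) λ ()

dropIndices⁺ : (𝒜 : SetSystem r m) (N : Subset r) {e : Fin m} {j : Fin r} →
  e ∈ 𝒜 j → j ∉ N → e ∈ dropIndices 𝒜 N j
dropIndices⁺ 𝒜 N {e} {j} e∈ j∉N with lookup N j in eq
... | true = ⊥-elim (j∉N (lookup⇒[]= j N eq))
... | false = e∈

supp-dropIndices : (𝒜 : SetSystem r m) (N : Subset r) (S : Subset m) →
  supp 𝒜 S ⊆ supp (dropIndices 𝒜 N) S ∪ N
supp-dropIndices 𝒜 N S {i} i∈s with i ∈? N
... | yes i∈N = x∈p∪q⁺ (inj₂ i∈N)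
... | no i∉N with supp⁻ 𝒜 {S} i∈s
... | e , e∈S , e∈Aᵢ = x∈p∪q⁺ (inj₁ (supp⁺ (dropIndices 𝒜 N) {S} e∈S (dropIndices⁺ 𝒜 N e∈Aᵢ i∉N)))

glue : (𝒜 : SetSystem r m) (N : Subset r) (Z T : Subset m) (indT : Indep 𝒜 T) →
  (∀ e e∈T → proj₁ indT e e∈T ∈ N) → Indep (dropIndices 𝒜 N) (Z ─ T) → Indep 𝒜 Z
glue {r} {m} 𝒜 N Z T (φ₁ , adj₁ , inj₁') intoN (φ₂ , adj₂ , inj₂') = φ , adj , inj
  where
  avoidsN : ∀ e e∈ → φ₂ e e∈ ∉ N
  avoidsN e e∈ = proj₂ (dropIndices⁻ 𝒜 N (adj₂ e e∈))
  ψ : (e : Fin m) → e ∈ Z → Dec (e ∈ T) → Fin r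
  ψ e e∈Z (yes e∈T) = φ₁ e e∈T
  ψ e e∈Z (no e∉T) = φ₂ e (x∈p∧x∉q⇒x∈p─q e∈Z e∉T)
  φ : (e : Fin m) → e ∈ Z → Fin r
  φ e e∈Z = ψ e e∈Z (e ∈? T)
  adjψ : ∀ e e∈Z d → e ∈ 𝒜 (ψ e e∈Z d)
  adjψ e e∈Z (yes e∈T) = adj₁ e e∈T
  adjψ e e∈Z (no e∉T) = proj₁ (dropIndices⁻ 𝒜 N (adj₂ e _))
  adj : ∀ e e∈Z → e ∈ 𝒜 (φ e e∈Z)
  adj e e∈Z = adjψ e e∈Z (e ∈? T)
  injψ : ∀ e f e∈Z f∈Z d d' → ψ e e∈Z d ≡ ψ f f∈Z d' → e ≡ f
  injψ e f _ _ (yes e∈T) (yes f∈T) eq = inj₁' e f e∈T f∈T eq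
  injψ e f _ _ (no _) (no _) eq = inj₂' e f _ _ eq
  injψ e f _ _ (yes e∈T) (no _) eq = ⊥-elim (avoidsN f _ (subst (_∈ N) eq (intoN e e∈T)))
  injψ e f _ _ (no _) (yes f∈T) eq = ⊥-elim (avoidsN e _ (subst (_∈ N) (sym eq) (intoN f f∈T)))
  inj : ∀ e f e∈Z f∈Z → φ e e∈Z ≡ φ f f∈Z → e ≡ f
  inj e f e∈Z f∈Z = injψ e f e∈Z f∈Z (e ∈? T) (f ∈? T)

HallUpTo : ℕ → ℕ → ℕ → Set
HallUpTo r m f = (𝒜 : SetSystem r m) (Z : Subset m) → ∣ Z ∣ ≤ f → HallCondition 𝒜 Z → Indep 𝒜 Z

-- Inductive step when some nonempty proper T ⊂ Z is critical (|s(T)| ≤ |T|): match T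
-- into s(T), and Z ─ T into the remaining indices; Hall's condition survives because
-- |S| + |T| ≤ |s(S ∪ T)| ≤ |s'(S)| + |s(T)| ≤ |s'(S)| + |T|.
hall-critical : ∀ {f} → HallUpTo r m f → (𝒜 : SetSystem r m) (Z T : Subset m) →
  ∣ Z ∣ ≤ suc f → HallCondition 𝒜 Z → T ⊂ Z → Nonempty T → ∣ supp 𝒜 T ∣ ≤ ∣ T ∣ → Indep 𝒜 Z
hall-critical {r = r} ih 𝒜 Z T ∣Z∣≤ hallZ T⊂Z (t , t∈T) critical = glue 𝒜 N Z T indT intoN indRest
  where
  N : Subset r
  N = supp 𝒜 T
  indT : Indep 𝒜 T
  indT = ih 𝒜 T (≤-pred (≤-trans (p⊂q⇒∣p∣<∣q∣ T⊂Z) ∣Z∣≤)) (λ S S⊆T → hallZ S (⊆-trans S⊆T (proj₁ T⊂Z)))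
  intoN : ∀ e e∈T → proj₁ indT e e∈T ∈ N
  intoN e e∈T = supp⁺ 𝒜 e∈T (proj₁ (proj₂ indT) e e∈T)
  hallRest : HallCondition (dropIndices 𝒜 N) (Z ─ T)
  hallRest S S⊆ = +-cancelʳ-≤ (∣ T ∣) (∣ S ∣) (∣ R ∣) (begin
    ∣ S ∣ + ∣ T ∣          ≡⟨ sym (∣p∪q∣≡∣p∣+∣q∣ S T (λ e∈S → proj₂ (x∈p─q⁻ Z T (S⊆ e∈S)))) ⟩
    ∣ S ∪ T ∣              ≤⟨ hallZ (S ∪ T) (∪-⊆ (λ e∈S → proj₁ (x∈p─q⁻ Z T (S⊆ e∈S))) (proj₁ T⊂Z)) ⟩
    ∣ supp 𝒜 (S ∪ T) ∣     ≤⟨ p⊆q⇒∣p∣≤∣q∣ supp-S∪T⊆ ⟩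
    ∣ R ∪ N ∣              ≤⟨ ∣p∪q∣≤∣p∣+∣q∣ R N ⟩
    ∣ R ∣ + ∣ N ∣          ≤⟨ +-monoʳ-≤ ∣ R ∣ critical ⟩
    ∣ R ∣ + ∣ T ∣          ∎)
    where
    open ≤-Reasoning
    R : Subset r
    R = supp (dropIndices 𝒜 N) S
    supp-S∪T⊆ : supp 𝒜 (S ∪ T) ⊆ R ∪ N
    supp-S∪T⊆ i∈ with supp⁻ 𝒜 i∈
    ... | e , e∈ , e∈Aᵢ with x∈p∪q⁻ S T e∈
    ... | inj₁ e∈S = supp-dropIndices 𝒜 N S (supp⁺ 𝒜 e∈S e∈Aᵢ)
    ... | inj₂ e∈T = x∈p∪q⁺ (inj₂ (supp⁺ 𝒜 e∈T e∈Aᵢ))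
  indRest : Indep (dropIndices 𝒜 N) (Z ─ T)
  indRest = ih (dropIndices 𝒜 N) (Z ─ T)
    (≤-pred (≤-trans (p∩q≢∅⇒∣p─q∣<∣p∣ Z T (t , x∈p∩q⁺ (proj₁ T⊂Z t∈T , t∈T))) ∣Z∣≤)) hallRest

-- Inductive step when every nonempty proper subset has surplus (|T| < |s(T)|): match any
-- e ∈ Z to some i with e ∈ A_i; removing the single index i keeps Hall's condition on Z - e.
hall-surplus : ∀ {f} → HallUpTo r m f → (𝒜 : SetSystem r m) (Z : Subset m) (e : Fin m) →
  e ∈ Z → ∣ Z ∣ ≤ suc f → HallCondition 𝒜 Z →
  (∀ T → T ⊂ Z → Nonempty T → ∣ T ∣ < ∣ supp 𝒜 T ∣) → Indep 𝒜 Z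
hall-surplus {r = r} ih 𝒜 Z e e∈Z ∣Z∣≤ hallZ surplus = glue 𝒜 N Z ⁅ e ⁆ ind-e intoN indRest
  where
  e∈⁅e⁆⊆Z : ⁅ e ⁆ ⊆ Z
  e∈⁅e⁆⊆Z x∈ = subst (_∈ Z) (sym (x∈⁅y⁆⇒x≡y e x∈)) e∈Z
  supp-e-nonempty : Nonempty (supp 𝒜 ⁅ e ⁆)
  supp-e-nonempty with nonempty? (supp 𝒜 ⁅ e ⁆)
  ... | yes ne = ne
  ... | no empty = contradiction (trans (sym (∣⁅x⁆∣≡1 e)) (≤-antisym (≤-trans (hallZ ⁅ e ⁆ e∈⁅e⁆⊆Z)
                     (≤-reflexive (∣Empty∣≡0 empty))) z≤n)) λ ()
  i : Fin r
  i = proj₁ supp-e-nonempty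
  e∈Aᵢ : e ∈ 𝒜 i
  e∈Aᵢ with supp⁻ 𝒜 (proj₂ supp-e-nonempty)
  ... | e' , e'∈⁅e⁆ , e'∈Aᵢ = subst (_∈ 𝒜 i) (x∈⁅y⁆⇒x≡y e e'∈⁅e⁆) e'∈Aᵢ
  N : Subset r
  N = ⁅ i ⁆
  ind-e : Indep 𝒜 ⁅ e ⁆
  ind-e = (λ _ _ → i) , (λ e' e'∈ → subst (_∈ 𝒜 i) (sym (x∈⁅y⁆⇒x≡y e e'∈)) e∈Aᵢ) ,
          (λ a b a∈ b∈ _ → trans (x∈⁅y⁆⇒x≡y e a∈) (sym (x∈⁅y⁆⇒x≡y e b∈)))
  intoN : ∀ e' e'∈ → proj₁ ind-e e' e'∈ ∈ N
  intoN _ _ = x∈⁅x⁆ i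
  hallRest : HallCondition (dropIndices 𝒜 N) (Z ─ ⁅ e ⁆)
  hallRest S S⊆ with nonempty? S
  ... | no empty = ≤-trans (≤-reflexive (∣Empty∣≡0 empty)) z≤n
  ... | yes neS = ≤-pred (begin
    suc ∣ S ∣              ≤⟨ surplus S S⊂Z neS ⟩
    ∣ supp 𝒜 S ∣           ≤⟨ p⊆q⇒∣p∣≤∣q∣ (supp-dropIndices 𝒜 N S) ⟩
    ∣ R ∪ N ∣              ≤⟨ ∣p∪q∣≤∣p∣+∣q∣ R N ⟩
    ∣ R ∣ + ∣ N ∣          ≡⟨ cong (∣ R ∣ +_) (∣⁅x⁆∣≡1 i) ⟩
    ∣ R ∣ + 1              ≡⟨ +-comm ∣ R ∣ 1 ⟩
    suc ∣ R ∣              ∎)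
    where
    open ≤-Reasoning
    R : Subset r
    R = supp (dropIndices 𝒜 N) S
    S⊂Z : S ⊂ Z
    S⊂Z = (λ x∈ → proj₁ (x∈p─q⁻ Z ⁅ e ⁆ (S⊆ x∈))) , e , e∈Z ,
          λ e∈S → proj₂ (x∈p─q⁻ Z ⁅ e ⁆ (S⊆ e∈S)) (x∈⁅x⁆ e)
  indRest : Indep (dropIndices 𝒜 N) (Z ─ ⁅ e ⁆)
  indRest = ih (dropIndices 𝒜 N) (Z ─ ⁅ e ⁆) (≤-pred (≤-trans (x∈p⇒∣p-x∣<∣p∣ e∈Z) ∣Z∣≤)) hallRest

hall : ∀ f → HallUpTo r m f
hall zero 𝒜 Z ∣Z∣≤0 _ = Indep-empty 𝒜 λ (e , e∈Z) → <⇒≱ (x∈p⇒∣p-x∣<∣p∣ e∈Z) (≤-trans ∣Z∣≤0 z≤n)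
hall (suc f) 𝒜 Z ∣Z∣≤ hallZ with nonempty? Z
... | no empty = Indep-empty 𝒜 empty
... | yes (e , e∈Z) with anySubset? (λ T → (T ⊂? Z) ×-dec nonempty? T ×-dec (∣ supp 𝒜 T ∣ <? suc ∣ T ∣))
... | yes (T , T⊂Z , neT , critical) = hall-critical (hall f) 𝒜 Z T ∣Z∣≤ hallZ T⊂Z neT (≤-pred critical)
... | no noCritical = hall-surplus (hall f) 𝒜 Z e e∈Z ∣Z∣≤ hallZ
        λ T T⊂Z neT → ≮⇒≥ λ c → noCritical (T , T⊂Z , neT , c)

indep-or-deficient : (𝒜 : SetSystem r m) (Z : Subset m) →
  Indep 𝒜 Z ⊎ ∃ λ T → T ⊆ Z × ∣ supp 𝒜 T ∣ < ∣ T ∣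
indep-or-deficient 𝒜 Z with anySubset? (λ T → (T ⊆? Z) ×-dec (∣ supp 𝒜 T ∣ <? ∣ T ∣))
... | yes deficient = inj₂ deficient
... | no none = inj₁ (hall _ 𝒜 Z ≤-refl λ T T⊆Z → ≮⇒≥ λ d → none (T , T⊆Z , d))

indep? : (𝒜 : SetSystem r m) (Z : Subset m) → Dec (Indep 𝒜 Z)
indep? 𝒜 Z with indep-or-deficient 𝒜 Z
... | inj₁ indZ = yes indZ
... | inj₂ (T , T⊆Z , deficient) = no λ indZ → <⇒≱ deficient (Indep⇒Hall 𝒜 indZ T T⊆Z)

-- Every independent W ⊆ G extends to a basis of M|G (greedily; f bounds the steps left).
extendToBasis : (𝒜 : SetSystem r m) (G : Subset m) → ∀ f (W : Subset m) → m ≤ f + ∣ W ∣ →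
  W ⊆ G → Indep 𝒜 W → Σ (Subset m) λ B → W ⊆ B × BasisOf 𝒜 G B
extendToBasis 𝒜 G f W bound W⊆G indW
  with any? (λ e → (e ∈? G) ×-dec ¬? (e ∈? W) ×-dec indep? 𝒜 (W ∪ ⁅ e ⁆))
... | no maximal = W , (λ e∈W → e∈W) , W⊆G , indW , λ e e∈G e∉W ind → maximal (e , e∈G , e∉W , ind)
extendToBasis 𝒜 G zero W bound W⊆G indW | yes (e , _ , e∉W , _) =
  contradiction (≤-trans (∣p∣≤n (W ∪ ⁅ e ⁆)) bound) (<⇒≱ (≤-reflexive (sym (∣p∪⁅x⁆∣≡1+∣p∣ W e e∉W))))
extendToBasis {m = m} 𝒜 G (suc f) W bound W⊆G indW | yes (e , e∈G , e∉W , ind)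
  with extendToBasis 𝒜 G f (W ∪ ⁅ e ⁆) bound' (∪-⊆ W⊆G λ x∈ → subst (_∈ G) (sym (x∈⁅y⁆⇒x≡y e x∈)) e∈G) ind
  where
  bound' : m ≤ f + ∣ W ∪ ⁅ e ⁆ ∣
  bound' = ≤-trans bound (≤-reflexive (trans (sym (+-suc f _)) (cong (f +_) (sym (∣p∪⁅x⁆∣≡1+∣p∣ W e e∉W)))))
... | B , W+e⊆B , basis = B , (λ e∈W → W+e⊆B (x∈p∪q⁺ (inj₁ e∈W))) , basis

-- Every dependent set contains a circuit (shrink while some deletion stays dependent).
circuitIn : (𝒜 : SetSystem r m) → ∀ f (Z : Subset m) → ∣ Z ∣ ≤ f → ¬ Indep 𝒜 Z →
  Σ (Subset m) λ C → C ⊆ Z × Circuit 𝒜 C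
circuitIn 𝒜 f Z ∣Z∣≤ dep with all? (λ e → (e ∈? Z) →-dec indep? 𝒜 (Z - e))
... | yes minimal = Z , (λ e∈Z → e∈Z) , dep , λ e e∈Z → minimal e e∈Z
... | no notMinimal with ¬∀⟶∃¬ _ _ (λ e → (e ∈? Z) →-dec indep? 𝒜 (Z - e)) notMinimal
... | e , ¬[e∈Z⇒ind] with e ∈? Z
... | no e∉Z = ⊥-elim (¬[e∈Z⇒ind] λ e∈Z → ⊥-elim (e∉Z e∈Z))
circuitIn 𝒜 zero Z ∣Z∣≤ dep | no _ | e , _ | yes e∈Z =
  contradiction (≤-trans (x∈p⇒∣p-x∣<∣p∣ e∈Z) ∣Z∣≤) λ ()
circuitIn 𝒜 (suc f) Z ∣Z∣≤ dep | no _ | e , ¬[e∈Z⇒ind] | yes e∈Z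
  with circuitIn 𝒜 f (Z - e) (≤-pred (≤-trans (x∈p⇒∣p-x∣<∣p∣ e∈Z) ∣Z∣≤)) (λ ind → ¬[e∈Z⇒ind] λ _ → ind)
... | C , C⊆Z-e , circuit = C , (λ c∈C → p─q⊆p Z ⁅ e ⁆ (C⊆Z-e c∈C)) , circuit

-- Adjoining x to the sets A_i, i ∈ I.  In M_I = M[𝒜^I] the new element x is zero and
-- e ∈ E is suc e, so a subset of E + x is  b ∷ X  with b recording whether x belongs.

module _ {n : ℕ} (𝒜 : SetSystem r n) (I : Subset r) where

  x∈Aᴵ⁻ : ∀ {i} → x₀ ∈ ext 𝒜 I i → i ∈ I
  x∈Aᴵ⁻ {i} x∈ = lookup⇒[]= i I ([]=⇒lookup x∈)

  x∈Aᴵ⁺ : ∀ {i} → i ∈ I → x₀ ∈ ext 𝒜 I i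
  x∈Aᴵ⁺ {i} i∈I = lookup⇒[]= zero (lookup I i ∷ 𝒜 i) ([]=⇒lookup i∈I)

  Indep-ext⁺ : ∀ {D} → Indep 𝒜 D → Indep (ext 𝒜 I) (false ∷ D)
  Indep-ext⁺ {D} (φ , adj , inj) = φ' , adj' , inj'
    where
    φ' : (e : Fin (suc n)) → e ∈ false ∷ D → Fin r
    φ' (suc e) e∈ = φ e (drop-there e∈)
    adj' : ∀ e e∈ → e ∈ ext 𝒜 I (φ' e e∈)
    adj' (suc e) e∈ = there (adj e (drop-there e∈))
    inj' : ∀ e f e∈ f∈ → φ' e e∈ ≡ φ' f f∈ → e ≡ f
    inj' (suc e) (suc f) e∈ f∈ eq = cong suc (inj e f _ _ eq)

  Indep-ext⁻ : ∀ {b D} → Indep (ext 𝒜 I) (b ∷ D) → Indep 𝒜 D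
  Indep-ext⁻ (φ , adj , inj) =
    (λ e e∈ → φ (suc e) (there e∈)) , (λ e e∈ → drop-there (adj (suc e) (there e∈))) ,
    (λ e f e∈ f∈ eq → suc-injective (inj (suc e) (suc f) (there e∈) (there f∈) eq))

  I∪supp⊆supp-ext : (T : Subset n) → I ∪ supp 𝒜 T ⊆ supp (ext 𝒜 I) (true ∷ T)
  I∪supp⊆supp-ext T = ∪-⊆ (λ i∈I → supp⁺ (ext 𝒜 I) {true ∷ T} here (x∈Aᴵ⁺ i∈I)) λ i∈s → viaE (supp⁻ 𝒜 {T} i∈s)
    where
    viaE : ∀ {i} → ∃ (λ e → e ∈ T × e ∈ 𝒜 i) → i ∈ supp (ext 𝒜 I) (true ∷ T)
    viaE (e , e∈T , e∈Aᵢ) = supp⁺ (ext 𝒜 I) {true ∷ T} (there e∈T) (there e∈Aᵢ)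

  -- Tightness lemma, (⇐): if X is tight and I ⊆ s(X), then X + x is dependent in M_I,
  -- since a transversal would inject X + x into s(X).
  tight⇒dependent : (X : Subset n) → Good1 𝒜 X → I ⊆ supp 𝒜 X → ¬ Indep (ext 𝒜 I) (true ∷ X)
  tight⇒dependent X (_ , ∣X∣≡∣sX∣) I⊆sX (φ , adj , inj) =
    <⇒≱ (injection⇒∣p∣≤∣q∣ (true ∷ X) (supp 𝒜 X) φ into inj) (≤-reflexive (sym ∣X∣≡∣sX∣))
    where
    into : ∀ e e∈ → φ e e∈ ∈ supp 𝒜 X
    into zero e∈ = I⊆sX (x∈Aᴵ⁻ (adj zero e∈))
    into (suc e) e∈ = supp⁺ 𝒜 (drop-there e∈) (drop-there (adj (suc e) e∈))

  -- Tightness lemma, (⇒): if B is independent in M but B + x is dependent in M_I, a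
  -- deficient subset T + x of B + x gives |I ∪ s(T)| ≤ |T| ≤ |s(T)|, so T is tight
  -- and I ⊆ s(T).
  dependent⇒tight : (B : Subset n) → Indep 𝒜 B → ¬ Indep (ext 𝒜 I) (true ∷ B) →
    Σ (Subset n) λ T → T ⊆ B × Good1 𝒜 T × I ⊆ supp 𝒜 T
  dependent⇒tight B indB dep with indep-or-deficient (ext 𝒜 I) (true ∷ B)
  ... | inj₁ ind = ⊥-elim (dep ind)
  ... | inj₂ (false ∷ T , T⊆ , deficient) =
    contradiction (Indep⇒Hall (ext 𝒜 I) (Indep-ext⁺ (Indep-⊆ 𝒜 (λ e∈ → drop-there (T⊆ (there e∈))) indB))
      (false ∷ T) (λ e∈ → e∈)) (<⇒≱ deficient)
  ... | inj₂ (true ∷ T , T⊆ , deficient) = T , T⊆B , (indT , ≤-antisym ∣T∣≤∣sT∣ ∣sT∣≤∣T∣) , I⊆sT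
    where
    T⊆B : T ⊆ B
    T⊆B e∈ = drop-there (T⊆ (there e∈))
    indT : Indep 𝒜 T
    indT = Indep-⊆ 𝒜 T⊆B indB
    ∣T∣≤∣sT∣ : ∣ T ∣ ≤ ∣ supp 𝒜 T ∣
    ∣T∣≤∣sT∣ = Indep⇒Hall 𝒜 indT T (λ e∈ → e∈)
    ∣I∪sT∣≤∣T∣ : ∣ I ∪ supp 𝒜 T ∣ ≤ ∣ T ∣
    ∣I∪sT∣≤∣T∣ = ≤-trans (p⊆q⇒∣p∣≤∣q∣ (I∪supp⊆supp-ext T)) (≤-pred deficient)
    ∣sT∣≤∣T∣ : ∣ supp 𝒜 T ∣ ≤ ∣ T ∣
    ∣sT∣≤∣T∣ = ≤-trans (p⊆q⇒∣p∣≤∣q∣ (q⊆p∪q I (supp 𝒜 T))) ∣I∪sT∣≤∣T∣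
    I⊆sT : I ⊆ supp 𝒜 T
    I⊆sT i∈I = ⊆∧∣q∣≤∣p∣⇒q⊆p (q⊆p∪q I (supp 𝒜 T)) (≤-trans ∣I∪sT∣≤∣T∣ ∣T∣≤∣sT∣) (x∈p∪q⁺ (inj₁ i∈I))

module _ {A : Set} (P : A → Set) (f : A → Subset r) where

  Separates : Subset r → Fin r → A → Set
  Separates I k a = P a × I ⊆ f a × k ∉ f a

  Separated : Subset r → Set
  Separated I = ∀ k → k ∉ I → ∃ (Separates I k)

  -- I is the intersection of f a over a finite list of elements with P (⋂ [] = ⊤).
  IntersectionOf : Subset r → Set
  IntersectionOf I = Σ (List A) λ as → All P as × I ≡ ⋂ (map f as)

  separators : ∀ {I} → Separated I → (ks : List (Fin r)) → Σ (List A) λ as → All P as ×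
    I ⊆ ⋂ (map f as) × (∀ k → k ∈ₗ ks → k ∉ I → k ∉ ⋂ (map f as))
  separators sep [] = [] , [] , (λ _ → ∈⊤) , λ k ()
  separators {I} sep (k ∷ ks) with separators sep ks | k ∈? I
  ... | as , Pas , I⊆ , excluded | yes k∈I =
    as , Pas , I⊆ , λ { _ (here refl) k∉I → ⊥-elim (k∉I k∈I) ; k' (there k'∈) → excluded k' k'∈ }
  ... | as , Pas , I⊆ , excluded | no k∉I with sep k k∉I
  ... | a , Pa , I⊆fa , k∉fa = a ∷ as , Pa ∷ Pas , (λ i∈I → x∈p∩q⁺ (I⊆fa i∈I , I⊆ i∈I)) ,
    λ { _ (here refl) _ k∈ → k∉fa (proj₁ (x∈p∩q⁻ _ _ k∈))
      ; k' (there k'∈) k'∉I k'∈⋂ → excluded k' k'∈ k'∉I (proj₂ (x∈p∩q⁻ _ _ k'∈⋂)) }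

  Separated⇒IntersectionOf : ∀ {I} → Separated I → IntersectionOf I
  Separated⇒IntersectionOf {I} sep with separators sep (allFin r)
  ... | as , Pas , I⊆ , excluded = as , Pas , ⊆-antisym I⊆ ⋂⊆I
    where
    ⋂⊆I : ⋂ (map f as) ⊆ I
    ⋂⊆I {k} k∈⋂ with k ∈? I
    ... | yes k∈I = k∈I
    ... | no k∉I = ⊥-elim (excluded k (∈-allFin k) k∉I k∈⋂)

  excluder : ∀ {k} as → All P as → k ∉ ⋂ (map f as) → ∃ λ a → Separates (⋂ (map f as)) k a
  excluder [] [] k∉⋂ = ⊥-elim (k∉⋂ ∈⊤)
  excluder {k} (a ∷ as) (Pa ∷ Pas) k∉⋂ with k ∈? f a
  ... | no k∉fa = a , Pa , (λ i∈ → proj₁ (x∈p∩q⁻ _ _ i∈)) , k∉fa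
  ... | yes k∈fa with excluder as Pas (λ k∈⋂ → k∉⋂ (x∈p∩q⁺ (k∈fa , k∈⋂)))
  ... | a' , Pa' , ⋂⊆ , k∉fa' = a' , Pa' , (λ i∈ → ⋂⊆ (proj₂ (x∈p∩q⁻ _ _ i∈))) , k∉fa'

  IntersectionOf⇒Separated : ∀ {I} → IntersectionOf I → Separated I
  IntersectionOf⇒Separated (as , Pas , refl) k k∉I = excluder as Pas k∉I

tight? : ∀ {n} (𝒜 : SetSystem r n) X → Dec (Good1 𝒜 X)
tight? 𝒜 X = indep? 𝒜 X ×-dec (∣ X ∣ ≟ ∣ supp 𝒜 X ∣)

module _ {n : ℕ} (𝒜 : SetSystem r n) (I : Subset r) where

  TightSeparated : Set
  TightSeparated = Separated (Good1 𝒜) (supp 𝒜) I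

  -- If x is a coloop of M_I \ A_k, no tight X separates k from I: X avoids A_k, so it
  -- extends to a basis B of M_I \ A_k; B contains x, so X + x would be independent.
  coloop⇒unseparated : ∀ {k} → IsColoop (ext 𝒜 I) (true ∷ ∁ (𝒜 k)) x₀ → ¬ ∃ (Separates (Good1 𝒜) (supp 𝒜) I k)
  coloop⇒unseparated {k} (_ , inEveryBasis) (X , tight , I⊆sX , k∉sX) =
    tight⇒dependent 𝒜 I X tight I⊆sX (Indep-⊆ (ext 𝒜 I) X+x⊆B (proj₁ (proj₂ basis)))
    where
    X⊆E-Aₖ : (false ∷ X) ⊆ (true ∷ ∁ (𝒜 k))
    X⊆E-Aₖ {suc e} e∈ with e ∈? 𝒜 k
    ... | yes e∈Aₖ = ⊥-elim (k∉sX (supp⁺ 𝒜 (drop-there e∈) e∈Aₖ))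
    ... | no e∉Aₖ = there (x∉p⇒x∈∁p e∉Aₖ)
    extended : Σ (Subset (suc n)) λ B → (false ∷ X) ⊆ B × BasisOf (ext 𝒜 I) (true ∷ ∁ (𝒜 k)) B
    extended = extendToBasis (ext 𝒜 I) (true ∷ ∁ (𝒜 k)) (suc n) (false ∷ X) (m≤m+n _ _) X⊆E-Aₖ
                 (Indep-ext⁺ 𝒜 I (proj₁ tight))
    B : Subset (suc n)
    B = proj₁ extended
    basis : BasisOf (ext 𝒜 I) (true ∷ ∁ (𝒜 k)) B
    basis = proj₂ (proj₂ extended)
    X+x⊆B : (true ∷ X) ⊆ B
    X+x⊆B {zero} here = inEveryBasis B basis
    X+x⊆B {suc e} (there e∈X) = proj₁ (proj₂ extended) (there e∈X)

  -- If no tight set separates k from I, then x is a coloop of M_I \ A_k: a basis B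
  -- missing x has B + x dependent, so the tightness lemma finds a tight separator in B.
  unseparated⇒coloop : ∀ {k} → ¬ ∃ (Separates (Good1 𝒜) (supp 𝒜) I k) → IsColoop (ext 𝒜 I) (true ∷ ∁ (𝒜 k)) x₀
  unseparated⇒coloop {k} none = here , inEveryBasis
    where
    inEveryBasis : ∀ B → BasisOf (ext 𝒜 I) (true ∷ ∁ (𝒜 k)) B → x₀ ∈ B
    inEveryBasis (true ∷ B) _ = here
    inEveryBasis (false ∷ B) (B⊆E-Aₖ , indB , maximal) with dependent⇒tight 𝒜 I B (Indep-ext⁻ 𝒜 I indB) dep
      where
      dep : ¬ Indep (ext 𝒜 I) (true ∷ B)
      dep = subst (λ D → ¬ Indep (ext 𝒜 I) (true ∷ D)) (∪-identityʳ B) (maximal zero here λ ())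
    ... | X , X⊆B , tight , I⊆sX = ⊥-elim (none (X , tight , I⊆sX , k∉sX))
      where
      k∉sX : k ∉ supp 𝒜 X
      k∉sX k∈ with supp⁻ 𝒜 k∈
      ... | e , e∈X , e∈Aₖ = x∈∁p⇒x∉p (drop-there (B⊆E-Aₖ (there (X⊆B e∈X)))) e∈Aₖ

  InL⇒TightSeparated : InL 𝒜 I → TightSeparated
  InL⇒TightSeparated closed k k∉I
    with anySubset? (λ X → tight? 𝒜 X ×-dec (I ⊆? supp 𝒜 X) ×-dec ¬? (k ∈? supp 𝒜 X))
  ... | yes separator = separator
  ... | no none = ⊥-elim (k∉I (proj₁ (closed k) (inj₂ (k∉I , unseparated⇒coloop none))))

  TightSeparated⇒InL : TightSeparated → InL 𝒜 I
  TightSeparated⇒InL separated k = σ⊆I , inj₁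
    where
    σ⊆I : k ∈σ[ 𝒜 ] I → k ∈ I
    σ⊆I (inj₁ k∈I) = k∈I
    σ⊆I (inj₂ (k∉I , coloop)) = ⊥-elim (coloop⇒unseparated coloop (separated k k∉I))

  -- Circuits of M_I through x.  C - x is independent and C is dependent, so the
  -- tightness lemma gives a tight T ⊆ C - x with I ⊆ s(T) ⊆ s(C - x).
  I⊆supp-circuit : ∀ C → Circuit (ext 𝒜 I) C → x₀ ∈ C → I ⊆ supp 𝒜 (tail C)
  I⊆supp-circuit (true ∷ D) (dep , minimal) here with dependent⇒tight 𝒜 I D indD dep
    where
    indD : Indep 𝒜 D
    indD = subst (Indep 𝒜) (p─⊥≡p D) (Indep-ext⁻ 𝒜 I (minimal zero here))
  ... | T , T⊆D , _ , I⊆sT = λ i∈I → supp-mono 𝒜 T⊆D (I⊆sT i∈I)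

  -- Conversely a tight separator X of k gives a dependent X + x, hence a circuit inside
  -- it; that circuit passes through x (X is independent) and its support misses k.
  separated⇒circuit : ∀ {k} → ∃ (Separates (Good1 𝒜) (supp 𝒜) I k) →
    ∃ λ C → Circuit (ext 𝒜 I) C × x₀ ∈ C × k ∉ supp 𝒜 (tail C)
  separated⇒circuit (X , tight , I⊆sX , k∉sX)
    with circuitIn (ext 𝒜 I) (suc n) (true ∷ X) (∣p∣≤n (true ∷ X)) (tight⇒dependent 𝒜 I X tight I⊆sX)
  ... | false ∷ D , C⊆ , (dep , _) =
    ⊥-elim (dep (Indep-ext⁺ 𝒜 I (Indep-⊆ 𝒜 (λ e∈ → drop-there (C⊆ (there e∈))) (proj₁ tight))))
  ... | true ∷ D , C⊆ , circuit =
    true ∷ D , circuit , here , λ k∈ → k∉sX (supp-mono 𝒜 (λ e∈ → drop-there (C⊆ (there e∈))) k∈)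

  inAllCircuits⇒∈ : TightSeparated → ∀ i →
    (∀ C → Circuit (ext 𝒜 I) C → x₀ ∈ C → i ∈ supp 𝒜 (tail C)) → i ∈ I
  inAllCircuits⇒∈ separated i inAll with i ∈? I
  ... | yes i∈I = i∈I
  ... | no i∉I with separated⇒circuit (separated i i∉I)
  ... | C , circuit , x∈C , i∉sC = ⊥-elim (i∉sC (inAll C circuit x∈C))

module _ {n : ℕ} (𝒜 : SetSystem r n) where

  Good1⇒Good1' : ∀ {X} → Good1 𝒜 X → Good1' 𝒜 X
  Good1⇒Good1' {X} (indX , ∣X∣≡∣sX∣) = (X , (λ e∈ → e∈) , indX , ∣X∣≡∣sX∣) ,
    λ W W⊆X indW → ≤-trans (Indep⇒Hall 𝒜 indW W λ e∈ → e∈) (p⊆q⇒∣p∣≤∣q∣ (supp-mono 𝒜 W⊆X))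

  -- If r(Y) = |s(Y)| via independent X ⊆ Y, then |s(Y)| = |X| ≤ |s(X)| forces s(X) = s(Y),
  -- and X is tight.
  Good1'⇒Good1 : ∀ {Y} → Good1' 𝒜 Y → Σ (Subset n) λ X → Good1 𝒜 X × supp 𝒜 X ≡ supp 𝒜 Y
  Good1'⇒Good1 {Y} ((X , X⊆Y , indX , ∣X∣≡∣sY∣) , _) = X , (indX , trans ∣X∣≡∣sY∣ (cong ∣_∣ (sym sX≡sY))) , sX≡sY
    where
    sX≡sY : supp 𝒜 X ≡ supp 𝒜 Y
    sX≡sY = ⊆-antisym (supp-mono 𝒜 X⊆Y)
      (⊆∧∣q∣≤∣p∣⇒q⊆p (supp-mono 𝒜 X⊆Y) (≤-trans (≤-reflexive (sym ∣X∣≡∣sY∣)) (Indep⇒Hall 𝒜 indX X λ e∈ → e∈)))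

  Separated-Good1⇒Good1' : ∀ {I} → Separated (Good1 𝒜) (supp 𝒜) I → Separated (Good1' 𝒜) (supp 𝒜) I
  Separated-Good1⇒Good1' separated k k∉I with separated k k∉I
  ... | X , tight , I⊆ , k∉ = X , Good1⇒Good1' tight , I⊆ , k∉

  Separated-Good1'⇒Good1 : ∀ {I} → Separated (Good1' 𝒜) (supp 𝒜) I → Separated (Good1 𝒜) (supp 𝒜) I
  Separated-Good1'⇒Good1 separated k k∉I with separated k k∉I
  ... | Y , good , I⊆sY , k∉sY with Good1'⇒Good1 good
  ... | X , tight , sX≡sY rewrite sym sX≡sY = X , tight , I⊆sY , k∉sY

theorem3p7 : (r n : ℕ) (𝒜 : SetSystem r n) → HasRank 𝒜 ⊤ r →
    ((I : Subset r) →
      (InL 𝒜 I → Σ (List (Subset n)) λ Xs → All (Good1 𝒜) Xs × I ≡ ⋂ (map (supp 𝒜) Xs)) ×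
      ((Σ (List (Subset n)) λ Xs → All (Good1 𝒜) Xs × I ≡ ⋂ (map (supp 𝒜) Xs)) → InL 𝒜 I)) ×
    ((I : Subset r) → InL 𝒜 I → (i : Fin r) →
      (i ∈ I → ∀ C → Circuit (ext 𝒜 I) C → x₀ ∈ C → i ∈ supp 𝒜 (tail C)) ×
      ((∀ C → Circuit (ext 𝒜 I) C → x₀ ∈ C → i ∈ supp 𝒜 (tail C)) → i ∈ I)) ×
    ((I : Subset r) →
      (InL 𝒜 I → Σ (List (Subset n)) λ Ys → All (Good1' 𝒜) Ys × I ≡ ⋂ (map (supp 𝒜) Ys)) ×
      ((Σ (List (Subset n)) λ Ys → All (Good1' 𝒜) Ys × I ≡ ⋂ (map (supp 𝒜) Ys)) → InL 𝒜 I))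
theorem3p7 r n 𝒜 _ =
  (λ I → (λ closed → Separated⇒IntersectionOf (Good1 𝒜) (supp 𝒜) (InL⇒TightSeparated 𝒜 I closed)) ,
         (λ rep → TightSeparated⇒InL 𝒜 I (IntersectionOf⇒Separated (Good1 𝒜) (supp 𝒜) rep))) ,
  (λ I closed i → (λ i∈I C circuit x∈C → I⊆supp-circuit 𝒜 I C circuit x∈C i∈I) ,
                  inAllCircuits⇒∈ 𝒜 I (InL⇒TightSeparated 𝒜 I closed) i) ,
  (λ I → (λ closed → Separated⇒IntersectionOf (Good1' 𝒜) (supp 𝒜)
                       (Separated-Good1⇒Good1' 𝒜 (InL⇒TightSeparated 𝒜 I closed))) ,
         (λ rep → TightSeparated⇒InL 𝒜 I
                    (Separated-Good1'⇒Good1 𝒜 (IntersectionOf⇒Separated (Good1' 𝒜) (supp 𝒜) rep))))
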